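{- Let $G$ be a graph of order $v$ with average vertex degree $D$, and let $n<v$ be a positive integer. Then \[ N(G,n)\le\left\lfloor\frac{(v-D-1)n}{v-n}\right\rfloor. \]
   Context: All graphs are finite simple graphs. An $n$-coloring of a graph $G$ is a proper vertex coloring using at most $n$ colors. Two colorings $C_1,C_2$ of $G$ are orthogonal if whenever two distinct vertices share a color in $C_1$, they have distinct colors in $C_2$. $N(G,n)$ denotes the maximum size of a set of pairwise orthogonal $n$-colorings of $G$. -}

module Defs where

open import Data.Bool using (Bool; true; false; if_then_else_)
open import Data.Nat as ℕ using (ℕ; zero; suc; _<_; NonZero; >-nonZero; z≤n)
open import Data.Nat.Properties using (m<n⇒0<n∸m; ≤-<-trans)
open import Data.Integer as ℤ using (ℤ; +_)
open import Data.Rational as ℚ using (ℚ; _/_; floor)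
open import Data.Fin using (Fin)
open import Data.List using (map; allFin)
open import Data.Nat.ListAction using (sum)
open import Relation.Binary.PropositionalEquality using (_≡_; _≢_)

record Graph (v : ℕ) : Set where
  field
    adj    : Fin v → Fin v → Bool
    sym    : ∀ x y → adj x y ≡ adj y x
    irrefl : ∀ x → adj x x ≡ false
open Graph public

degree : ∀ {v} → Graph v → Fin v → ℕ
degree {v} G x = sum (map (λ y → if adj G x y then 1 else 0) (allFin v))

degreeSum : ∀ {v} → Graph v → ℕ
degreeSum {v} G = sum (map (degree G) (allFin v))

averageDegree : ∀ {v} → Graph v → 0 < v → ℚ
averageDegree {v} G 0<v = (+ degreeSum G / v) {{>-nonZero 0<v}}

-- an n-coloring: a proper vertex coloring using at most n colors
record Coloring {v : ℕ} (G : Graph v) (n : ℕ) : Set where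
  field
    col    : Fin v → Fin n
    proper : ∀ x y → adj G x y ≡ true → col x ≢ col y
open Coloring public

Orthogonal : ∀ {v n} {G : Graph v} → Coloring G n → Coloring G n → Set
Orthogonal {v} C₁ C₂ = ∀ (x y : Fin v) → x ≢ y → col C₁ x ≡ col C₁ y → col C₂ x ≢ col C₂ y

PairwiseOrthogonal : ∀ {v n k} {G : Graph v} → (Fin k → Coloring G n) → Set
PairwiseOrthogonal {k = k} F = ∀ (i j : Fin k) → i ≢ j → Orthogonal (F i) (F j)

bound : ∀ {v} (G : Graph v) (n : ℕ) → 0 < n → n < v → ℤ
bound {v} G n 0<n n<v =
  floor (((+ v / 1 ℚ.- averageDegree G 0<v ℚ.- + 1 / 1) ℚ.* (+ n / 1))
          ℚ.* (+ 1 / (v ℕ.∸ n)) {{>-nonZero (m<n⇒0<n∸m n<v)}})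
  where
  0<v : 0 < v
  0<v = ≤-<-trans z≤n n<v

module Submission where

-- Let C₁, …, C_k be pairwise orthogonal n-colorings of a graph G of order v
-- with degree sum S = v·D, and count the ordered pairs (x, y) of vertices
-- together with an index i such that Cᵢ(x) = Cᵢ(y).
--   * Lower bound.  If the colour classes of Cᵢ have sizes s₁, …, s_n, then
--     Cᵢ contributes Σ s_c² ≥ (Σ s_c)² / n = v² / n (Cauchy–Schwarz).
--   * Upper bound.  A pair (x, x) is counted k times, an adjacent pair never
--     (the colorings are proper), and by orthogonality every other pair at
--     most once; so the count plus S plus v is at most k·v + v².
-- Hence k·v² + n·(S + v) ≤ n·(k·v + v²), i.e. k·v·(v - n) ≤ (v² - S - v)·n,
-- which says k ≤ (v - D - 1)·n / (v - n); as k is an integer, it is at most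
-- the floor.

open import Defs
open import Data.Nat using (ℕ; _<_)
open import Data.Fin using (Fin)
open import Data.Integer using (+_; _≤_)

open import Data.Bool using (Bool; true; false; if_then_else_)
open import Data.Nat as ℕ using (zero; suc; _+_; _*_; _∸_; z≤n; s≤s; NonZero)
import Data.Nat.Properties as ℕP
open import Data.Nat.Tactic.RingSolver as ℕSolver using ()
import Data.Nat.ListAction as List
open import Data.Fin using (zero; suc)
open import Data.Fin.Properties using (_≟_; suc-injective)
open import Data.List using (map; allFin; tabulate)
open import Data.List.Properties using (map-tabulate)
open import Data.Sum using (inj₁; inj₂)
open import Data.Integer as ℤ using (ℤ; -_)
import Data.Integer.Properties as ℤP
open import Data.Integer.DivMod using (div-pos-is-/ℕ; n<s[n/ℕd]*d)
open import Data.Integer.Tactic.RingSolver as ℤSolver using ()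
open import Data.Rational as ℚ using (ℚ; floor; toℚᵘ)
import Data.Rational.Properties as ℚP
open import Data.Rational.Unnormalised as ℚᵘ using (ℚᵘ; *≤*)
import Data.Rational.Unnormalised.Properties as ℚᵘP
open import Function.Bundles using (mk⇔)
open import Relation.Nullary using (Dec; yes; no; does; ¬_)
open import Relation.Nullary.Decidable using (dec-false; does-⇔)
open import Relation.Binary.PropositionalEquality
  using (_≡_; _≢_; refl; trans; cong; cong₂; subst; subst₂; module ≡-Reasoning)
  renaming (sym to ≡-sym)
open import Algebra.Properties.Semiring.Sum ℕP.+-*-semiring
  using (sum; sum-syntax; sum-cong-≗; sum-replicate-zero; ∑-distrib-+; ∑-comm; *-distribˡ-sum; *-distribʳ-sum)

∑-mono-≤ : ∀ {n} {f g : Fin n → ℕ} → (∀ i → f i ℕ.≤ g i) → ∑[ i < n ] f i ℕ.≤ ∑[ i < n ] g i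
∑-mono-≤ {zero}  f≤g = z≤n
∑-mono-≤ {suc n} f≤g = ℕP.+-mono-≤ (f≤g zero) (∑-mono-≤ (λ i → f≤g (suc i)))

∑-const : ∀ n c → ∑[ i < n ] c ≡ n * c
∑-const zero    c = refl
∑-const (suc n) c = cong (c ℕ.+_) (∑-const n c)

listSum≡∑ : ∀ n (f : Fin n → ℕ) → List.sum (map f (allFin n)) ≡ ∑[ i < n ] f i
listSum≡∑ n f = trans (cong List.sum (map-tabulate (λ i → i) f)) (tabulated n f)
  where
  tabulated : ∀ n (f : Fin n → ℕ) → List.sum (tabulate f) ≡ ∑[ i < n ] f i
  tabulated zero    f = refl
  tabulated (suc n) f = cong (f zero ℕ.+_) (tabulated n (λ i → f (suc i)))

[_] : Bool → ℕ
[ b ] = if b then 1 else 0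

[]-≤1 : ∀ b → [ b ] ℕ.≤ 1
[]-≤1 true  = s≤s z≤n
[]-≤1 false = z≤n

[no] : ∀ {P : Set} (P? : Dec P) → ¬ P → [ does P? ] ≡ 0
[no] P? ¬p = cong [_] (dec-false P? ¬p)

∑-select : ∀ {n} (a : Fin n) (f : Fin n → ℕ) → ∑[ c < n ] ([ does (a ≟ c) ] * f c) ≡ f a
∑-select {suc n} zero f = begin
  1 * f zero + ∑[ c < n ] ([ does (zero ≟ suc c) ] * f (suc c))  ≡⟨⟩
  f zero + 0 + ∑[ c < n ] 0                                       ≡⟨ cong (f zero + 0 ℕ.+_) (∑-const n 0) ⟩
  f zero + 0 + n * 0                                              ≡⟨ ring (f zero) n ⟩
  f zero                                                          ∎
  where
  open ≡-Reasoning
  ring : ∀ x n → x + 0 + n * 0 ≡ x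
  ring = ℕSolver.solve-∀
∑-select {suc n} (suc a) f = ∑-select a (λ c → f (suc c))

∑-indicator : ∀ {n} (a : Fin n) → ∑[ c < n ] [ does (a ≟ c) ] ≡ 1
∑-indicator {n} a = trans (sum-cong-≗ (λ c → ≡-sym (ℕP.*-identityʳ [ does (a ≟ c) ]))) (∑-select a (λ _ → 1))

∑-exclusive-≤1 : ∀ {k} {P : Fin k → Set} (P? : ∀ i → Dec (P i)) →
                 (∀ i j → i ≢ j → P i → ¬ P j) → ∑[ i < k ] [ does (P? i) ] ℕ.≤ 1
∑-exclusive-≤1 {zero}  P? excl = z≤n
∑-exclusive-≤1 {suc k} P? excl with P? zero
... | yes p = ℕP.≤-reflexive (cong suc (trans (sum-cong-≗ others-fail) (sum-replicate-zero k)))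
  where
  others-fail : ∀ j → [ does (P? (suc j)) ] ≡ 0
  others-fail j = [no] (P? (suc j)) (excl zero (suc j) (λ ()) p)
... | no _  = ∑-exclusive-≤1 (λ i → P? (suc i))
                (λ i j i≢j → excl (suc i) (suc j) (λ i≡j → i≢j (suc-injective i≡j)))

-- The case b = a + t: a² + (a + t)² = 2a(a + t) + t².
2ab≤a²+b²-ordered : ∀ a t → 2 * (a * (a + t)) ℕ.≤ a * a + (a + t) * (a + t)
2ab≤a²+b²-ordered a t = subst (2 * (a * (a + t)) ℕ.≤_) (square a t) (ℕP.m≤m+n _ (t * t))
  where
  square : ∀ a t → 2 * (a * (a + t)) + t * t ≡ a * a + (a + t) * (a + t)
  square = ℕSolver.solve-∀

2ab≤a²+b² : ∀ a b → 2 * (a * b) ℕ.≤ a * a + b * b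
2ab≤a²+b² a b with ℕP.≤-total a b
... | inj₁ a≤b = subst (λ b → 2 * (a * b) ℕ.≤ a * a + b * b) (ℕP.m+[n∸m]≡n a≤b) (2ab≤a²+b²-ordered a (b ∸ a))
... | inj₂ b≤a = subst₂ ℕ._≤_ (cong (2 *_) (ℕP.*-comm b a)) (ℕP.+-comm (b * b) (a * a))
                   (subst (λ a → 2 * (b * a) ℕ.≤ b * b + a * a) (ℕP.m+[n∸m]≡n b≤a) (2ab≤a²+b²-ordered b (a ∸ b)))

-- 2(Σ f)² = Σ_c Σ_d 2 f_c f_d ≤ Σ_c Σ_d (f_c² + f_d²) = 2 n Σ f².
cauchy-schwarz : ∀ n (f : Fin n → ℕ) →
                 (∑[ c < n ] f c) * (∑[ c < n ] f c) ℕ.≤ n * ∑[ c < n ] (f c * f c)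
cauchy-schwarz n f = ℕP.*-cancelˡ-≤ 2 (begin
  2 * (Σf * Σf)                                        ≡⟨ cong (2 *_) (*-distribʳ-sum Σf f) ⟩
  2 * ∑[ c < n ] (f c * Σf)                            ≡⟨ cong (2 *_) (sum-cong-≗ {n} (λ c → *-distribˡ-sum (f c) f)) ⟩
  2 * ∑[ c < n ] ∑[ d < n ] (f c * f d)                ≡⟨ *-distribˡ-sum {n} 2 _ ⟩
  ∑[ c < n ] (2 * ∑[ d < n ] (f c * f d))              ≡⟨ sum-cong-≗ {n} (λ c → *-distribˡ-sum {n} 2 _) ⟩
  ∑[ c < n ] ∑[ d < n ] (2 * (f c * f d))              ≤⟨ ∑-mono-≤ (λ c → ∑-mono-≤ (λ d → 2ab≤a²+b² (f c) (f d))) ⟩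
  ∑[ c < n ] ∑[ d < n ] (f c * f c + f d * f d)        ≡⟨ sum-cong-≗ {n} (λ c → ∑-distrib-+ {n} (λ _ → f c * f c) _) ⟩
  ∑[ c < n ] (∑[ d < n ] (f c * f c) + Q)              ≡⟨ ∑-distrib-+ {n} _ _ ⟩
  ∑[ c < n ] ∑[ d < n ] (f c * f c) + ∑[ c < n ] Q     ≡⟨ cong₂ _+_ (∑-comm {n} {n} (λ c d → f c * f c)) (∑-const n Q) ⟩
  ∑[ d < n ] Q + n * Q                                 ≡⟨ cong (_+ n * Q) (∑-const n Q) ⟩
  n * Q + n * Q                                        ≡⟨ cong (n * Q ℕ.+_) (≡-sym (ℕP.+-identityʳ (n * Q))) ⟩
  2 * (n * Q)                                          ∎)
  where
  open ℕP.≤-Reasoning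
  Σf = ∑[ c < n ] f c
  Q  = ∑[ c < n ] (f c * f c)

module _ {v n : ℕ} (c : Fin v → Fin n) where

  classSize : Fin n → ℕ
  classSize a = ∑[ x < v ] [ does (c x ≟ a) ]

  monochromaticPairs : ℕ
  monochromaticPairs = ∑[ x < v ] ∑[ y < v ] [ does (c x ≟ c y) ]

  ∑-classSize : ∑[ a < n ] classSize a ≡ v
  ∑-classSize = begin
    ∑[ a < n ] ∑[ x < v ] [ does (c x ≟ a) ]  ≡⟨ ∑-comm (λ a x → [ does (c x ≟ a) ]) ⟩
    ∑[ x < v ] ∑[ a < n ] [ does (c x ≟ a) ]  ≡⟨ sum-cong-≗ (λ x → ∑-indicator (c x)) ⟩
    ∑[ x < v ] 1                              ≡⟨ trans (∑-const v 1) (ℕP.*-identityʳ v) ⟩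
    v                                         ∎
    where open ≡-Reasoning

  monochromaticPairs≡∑classSize² : monochromaticPairs ≡ ∑[ a < n ] (classSize a * classSize a)
  monochromaticPairs≡∑classSize² = begin
    ∑[ x < v ] ∑[ y < v ] [ does (c x ≟ c y) ]                  ≡⟨ sum-cong-≗ (λ x → sum-cong-≗ (λ y → same-class x y)) ⟩
    ∑[ x < v ] ∑[ y < v ] ∑[ a < n ] (in-class x a * in-class y a) ≡⟨ sum-cong-≗ (λ x → ∑-comm (λ y a → in-class x a * in-class y a)) ⟩
    ∑[ x < v ] ∑[ a < n ] ∑[ y < v ] (in-class x a * in-class y a) ≡⟨ ∑-comm (λ x a → ∑[ y < v ] (in-class x a * in-class y a)) ⟩
    ∑[ a < n ] ∑[ x < v ] ∑[ y < v ] (in-class x a * in-class y a) ≡⟨ sum-cong-≗ (λ a → ≡-sym (class-square a)) ⟩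
    ∑[ a < n ] (classSize a * classSize a)                       ∎
    where
    open ≡-Reasoning
    in-class : Fin v → Fin n → ℕ
    in-class x a = [ does (c x ≟ a) ]
    same-class : ∀ x y → [ does (c x ≟ c y) ] ≡ ∑[ a < n ] (in-class x a * in-class y a)
    same-class x y = ≡-sym (trans (∑-select (c x) (in-class y))
                                (cong [_] (does-⇔ (mk⇔ ≡-sym ≡-sym) (c y ≟ c x) (c x ≟ c y))))
    class-square : ∀ a → classSize a * classSize a ≡ ∑[ x < v ] ∑[ y < v ] (in-class x a * in-class y a)
    class-square a = trans (*-distribʳ-sum (classSize a) (λ x → in-class x a))
                           (sum-cong-≗ (λ x → *-distribˡ-sum (in-class x a) (λ y → in-class y a)))

  monochromaticPairs-lower : v * v ℕ.≤ n * monochromaticPairs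
  monochromaticPairs-lower = begin
    v * v                                        ≡⟨ ≡-sym (cong₂ _*_ ∑-classSize ∑-classSize) ⟩
    (∑[ a < n ] classSize a) * (∑[ a < n ] classSize a) ≤⟨ cauchy-schwarz n classSize ⟩
    n * ∑[ a < n ] (classSize a * classSize a)   ≡⟨ cong (n *_) (≡-sym monochromaticPairs≡∑classSize²) ⟩
    n * monochromaticPairs                       ∎
    where open ℕP.≤-Reasoning

module _ {v n k : ℕ} {G : Graph v} (F : Fin k → Coloring G n) (orth : PairwiseOrthogonal F) where

  agreements : Fin v → Fin v → ℕ
  agreements x y = ∑[ i < k ] [ does (col (F i) x ≟ col (F i) y) ]

  agreements-edge : ∀ x y → adj G x y ≡ true → agreements x y ≡ 0
  agreements-edge x y xy-edge = trans (sum-cong-≗ disagree) (sum-replicate-zero k)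
    where
    disagree : ∀ i → [ does (col (F i) x ≟ col (F i) y) ] ≡ 0
    disagree i = [no] (col (F i) x ≟ col (F i) y) (proper (F i) x y xy-edge)

  agreements-distinct : ∀ x y → x ≢ y → agreements x y ℕ.≤ 1
  agreements-distinct x y x≢y =
    ∑-exclusive-≤1 (λ i → col (F i) x ≟ col (F i) y) (λ i j i≢j → orth i j i≢j x y x≢y)

  -- Per pair: all k colourings agree on (x, x), the edge indicator and
  -- the agreements together are at most 1 on any other pair.
  agreements-pair : ∀ x y → agreements x y + [ adj G x y ] + [ does (x ≟ y) ] ℕ.≤ k * [ does (x ≟ y) ] + 1
  agreements-pair x y with x ≟ y
  ... | yes refl rewrite irrefl G x = ℕP.+-monoˡ-≤ 1 (begin
    agreements x x + 0  ≡⟨ ℕP.+-identityʳ _ ⟩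
    agreements x x      ≤⟨ ∑-mono-≤ (λ i → []-≤1 (does (col (F i) x ≟ col (F i) x))) ⟩
    ∑[ i < k ] 1        ≡⟨ ∑-const k 1 ⟩
    k * 1               ∎)
    where open ℕP.≤-Reasoning
  ... | no x≢y with adj G x y in xy-edge
  ...   | true  rewrite ℕP.*-zeroʳ k | agreements-edge x y xy-edge = ℕP.≤-refl
  ...   | false rewrite ℕP.*-zeroʳ k | ℕP.+-identityʳ (agreements x y) | ℕP.+-identityʳ (agreements x y) =
    agreements-distinct x y x≢y

  agreements-total : ∑[ i < k ] monochromaticPairs (col (F i)) + (degreeSum G + v) ℕ.≤ k * v + v * v
  agreements-total = begin
    ∑[ i < k ] monochromaticPairs (col (F i)) + (degreeSum G + v)
      ≡⟨ cong₂ _+_ agreements-swap (cong₂ _+_ degreeSum≡ diagonal) ⟩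
    ∑[ x < v ] ∑[ y < v ] agreements x y + (∑[ x < v ] ∑[ y < v ] [ adj G x y ] + ∑[ x < v ] ∑[ y < v ] [ does (x ≟ y) ])
      ≡⟨ ≡-sym (ℕP.+-assoc (∑[ x < v ] ∑[ y < v ] agreements x y) _ _) ⟩
    ∑[ x < v ] ∑[ y < v ] agreements x y + ∑[ x < v ] ∑[ y < v ] [ adj G x y ] + ∑[ x < v ] ∑[ y < v ] [ does (x ≟ y) ]
      ≡⟨ ≡-sym (∑∑-distrib-+₃ agreements (λ x y → [ adj G x y ]) (λ x y → [ does (x ≟ y) ])) ⟩
    ∑[ x < v ] ∑[ y < v ] (agreements x y + [ adj G x y ] + [ does (x ≟ y) ])
      ≤⟨ ∑-mono-≤ (λ x → ∑-mono-≤ (λ y → agreements-pair x y)) ⟩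
    ∑[ x < v ] ∑[ y < v ] (k * [ does (x ≟ y) ] + 1)
      ≡⟨ sum-cong-≗ (λ x → row x) ⟩
    ∑[ x < v ] (k + v)
      ≡⟨ ∑-const v (k + v) ⟩
    v * (k + v)
      ≡⟨ trans (ℕP.*-distribˡ-+ v k v) (cong (_+ v * v) (ℕP.*-comm v k)) ⟩
    k * v + v * v ∎
    where
    open ℕP.≤-Reasoning
    agreements-swap : ∑[ i < k ] monochromaticPairs (col (F i)) ≡ ∑[ x < v ] ∑[ y < v ] agreements x y
    agreements-swap = trans (∑-comm (λ i x → ∑[ y < v ] [ does (col (F i) x ≟ col (F i) y) ]))
                            (sum-cong-≗ (λ x → ∑-comm (λ i y → [ does (col (F i) x ≟ col (F i) y) ])))
    degreeSum≡ : degreeSum G ≡ ∑[ x < v ] ∑[ y < v ] [ adj G x y ]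
    degreeSum≡ = trans (listSum≡∑ v (degree G)) (sum-cong-≗ (λ x → listSum≡∑ v (λ y → [ adj G x y ])))
    diagonal : v ≡ ∑[ x < v ] ∑[ y < v ] [ does (x ≟ y) ]
    diagonal = ≡-sym (trans (sum-cong-≗ {v} ∑-indicator) (trans (∑-const v 1) (ℕP.*-identityʳ v)))
    ∑∑-distrib-+₃ : ∀ (f g h : Fin v → Fin v → ℕ) →
      ∑[ x < v ] ∑[ y < v ] (f x y + g x y + h x y) ≡
      ∑[ x < v ] ∑[ y < v ] f x y + ∑[ x < v ] ∑[ y < v ] g x y + ∑[ x < v ] ∑[ y < v ] h x y
    ∑∑-distrib-+₃ f g h =
      trans (sum-cong-≗ (λ x → trans (∑-distrib-+ _ (h x)) (cong (_+ ∑[ y < v ] h x y) (∑-distrib-+ (f x) (g x)))))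
            (trans (∑-distrib-+ {v} _ _) (cong (_+ ∑[ x < v ] ∑[ y < v ] h x y) (∑-distrib-+ {v} _ _)))
    row : ∀ x → ∑[ y < v ] (k * [ does (x ≟ y) ] + 1) ≡ k + v
    row x = begin-equality
      ∑[ y < v ] (k * [ does (x ≟ y) ] + 1)             ≡⟨ ∑-distrib-+ {v} _ _ ⟩
      ∑[ y < v ] (k * [ does (x ≟ y) ]) + ∑[ y < v ] 1  ≡⟨ cong₂ _+_ (≡-sym (*-distribˡ-sum {v} k _)) (∑-const v 1) ⟩
      k * ∑[ y < v ] [ does (x ≟ y) ] + v * 1           ≡⟨ cong₂ _+_ (cong (k *_) (∑-indicator x)) (ℕP.*-identityʳ v) ⟩
      k * 1 + v                                         ≡⟨ cong (_+ v) (ℕP.*-identityʳ k) ⟩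
      k + v                                             ∎

  -- Combining n times the upper bound with the k lower bounds v² ≤ n·Mᵢ.
  counting-inequality : k * (v * v) + n * (degreeSum G + v) ℕ.≤ n * (k * v + v * v)
  counting-inequality = begin
    k * (v * v) + n * (degreeSum G + v)
      ≡⟨ cong (_+ n * (degreeSum G + v)) (≡-sym (∑-const k (v * v))) ⟩
    ∑[ i < k ] (v * v) + n * (degreeSum G + v)
      ≤⟨ ℕP.+-monoˡ-≤ _ (∑-mono-≤ (λ i → monochromaticPairs-lower (col (F i)))) ⟩
    ∑[ i < k ] (n * monochromaticPairs (col (F i))) + n * (degreeSum G + v)
      ≡⟨ cong (_+ n * (degreeSum G + v)) (≡-sym (*-distribˡ-sum {k} n _)) ⟩
    n * M + n * (degreeSum G + v)
      ≡⟨ ≡-sym (ℕP.*-distribˡ-+ n M _) ⟩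
    n * (M + (degreeSum G + v))
      ≤⟨ ℕP.*-monoʳ-≤ n agreements-total ⟩
    n * (k * v + v * v) ∎
    where
    open ℕP.≤-Reasoning
    M = ∑[ i < k ] monochromaticPairs (col (F i))

rearrange : ∀ {K V N S : ℤ} →
            K ℤ.* (V ℤ.* V) ℤ.+ N ℤ.* (S ℤ.+ V) ℤ.≤ N ℤ.* (K ℤ.* V ℤ.+ V ℤ.* V) →
            K ℤ.* (V ℤ.* (V ℤ.- N)) ℤ.≤ (V ℤ.* V ℤ.- S ℤ.- V) ℤ.* N
rearrange {K} {V} {N} {S} h = begin
  K ℤ.* (V ℤ.* (V ℤ.- N))                    ≡⟨ left K V N S ⟩
  K ℤ.* (V ℤ.* V) ℤ.+ N ℤ.* (S ℤ.+ V) ℤ.- X  ≤⟨ ℤP.+-monoˡ-≤ (- X) h ⟩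
  N ℤ.* (K ℤ.* V ℤ.+ V ℤ.* V) ℤ.- X          ≡⟨ right K V N S ⟩
  (V ℤ.* V ℤ.- S ℤ.- V) ℤ.* N                ∎
  where
  open ℤP.≤-Reasoning
  X = N ℤ.* (S ℤ.+ V) ℤ.+ N ℤ.* (K ℤ.* V)
  left : ∀ K V N S → K ℤ.* (V ℤ.* (V ℤ.- N)) ≡
         K ℤ.* (V ℤ.* V) ℤ.+ N ℤ.* (S ℤ.+ V) ℤ.- (N ℤ.* (S ℤ.+ V) ℤ.+ N ℤ.* (K ℤ.* V))
  left = ℤSolver.solve-∀
  right : ∀ K V N S → N ℤ.* (K ℤ.* V ℤ.+ V ℤ.* V) ℤ.- (N ℤ.* (S ℤ.+ V) ℤ.+ N ℤ.* (K ℤ.* V)) ≡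
          (V ℤ.* V ℤ.- S ℤ.- V) ℤ.* N
  right = ℤSolver.solve-∀

-- The counting inequality, cast from ℕ to ℤ and rearranged; for n ≤ v the
-- factor v - n is the natural subtraction v ∸ n.
counting-inequalityℤ : ∀ k v n S → n ℕ.≤ v →
                       k * (v * v) + n * (S + v) ℕ.≤ n * (k * v + v * v) →
                       + k ℤ.* (+ v ℤ.* + (v ∸ n)) ℤ.≤ (+ v ℤ.* + v ℤ.- + S ℤ.- + v) ℤ.* + n
counting-inequalityℤ k v n S n≤v h =
  subst (λ d → + k ℤ.* (+ v ℤ.* d) ℤ.≤ (+ v ℤ.* + v ℤ.- + S ℤ.- + v) ℤ.* + n) v-n≡v∸n
    (rearrange {+ k} {+ v} {+ n} {+ S} (subst₂ ℤ._≤_ cast-left cast-right (ℤ.+≤+ h)))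
  where
  v-n≡v∸n : + v ℤ.- + n ≡ + (v ∸ n)
  v-n≡v∸n = trans (ℤP.[+m]-[+n]≡m⊖n v n) (ℤP.⊖-≥ n≤v)
  cast-left : + (k * (v * v) + n * (S + v)) ≡ + k ℤ.* (+ v ℤ.* + v) ℤ.+ + n ℤ.* (+ S ℤ.+ + v)
  cast-left = trans (ℤP.pos-+ (k * (v * v)) (n * (S + v))) (cong₂ ℤ._+_
    (trans (ℤP.pos-* k (v * v)) (cong (+ k ℤ.*_) (ℤP.pos-* v v)))
    (trans (ℤP.pos-* n (S + v)) (cong (+ n ℤ.*_) (ℤP.pos-+ S v))))
  cast-right : + (n * (k * v + v * v)) ≡ + n ℤ.* (+ k ℤ.* + v ℤ.+ + v ℤ.* + v)
  cast-right = trans (ℤP.pos-* n (k * v + v * v)) (cong (+ n ℤ.*_)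
    (trans (ℤP.pos-+ (k * v) (v * v)) (cong₂ ℤ._+_ (ℤP.pos-* k v) (ℤP.pos-* v v))))

/ℕ-greatest : ∀ (n : ℤ) d .{{_ : NonZero d}} (m : ℤ) → m ℤ.* + d ℤ.≤ n → m ℤ.≤ n ℤ./ℕ d
/ℕ-greatest n d m md≤n =
  subst₂ ℤ._≤_ (ℤP.pred-suc m) (ℤP.pred-suc (n ℤ./ℕ d)) (ℤP.pred-mono (ℤP.i<j⇒suc[i]≤j m<1+n/d))
  where
  m<1+n/d : m ℤ.< ℤ.suc (n ℤ./ℕ d)
  m<1+n/d = ℤP.*-cancelʳ-<-nonNeg (+ d) (ℤP.≤-<-trans md≤n (n<s[n/ℕd]*d n d))

floor-greatest : ∀ (q : ℚ) (m : ℤ) → (m ℚᵘ./ 1) ℚᵘ.≤ toℚᵘ q → m ℤ.≤ floor q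
floor-greatest (ℚ.mkℚ n d-1 _) m (*≤* m≤q) =
  subst (m ℤ.≤_) (≡-sym (div-pos-is-/ℕ n (suc d-1)))
    (/ℕ-greatest n (suc d-1) m (subst (m ℤ.* + suc d-1 ℤ.≤_) (ℤP.*-identityʳ n) m≤q))

-- The rational expression inside the bound of Defs, with D = S / v,
-- and the same expression in unnormalised rationals.
boundℚ : (v d n S : ℕ) .{{_ : NonZero v}} .{{_ : NonZero d}} → ℚ
boundℚ v d n S = ((+ v ℚ./ 1 ℚ.- + S ℚ./ v ℚ.- + 1 ℚ./ 1) ℚ.* (+ n ℚ./ 1)) ℚ.* (+ 1 ℚ./ d)

boundᵘ : (v d n S : ℕ) .{{_ : NonZero v}} .{{_ : NonZero d}} → ℚᵘ
boundᵘ v d n S = ((+ v ℚᵘ./ 1 ℚᵘ.- + S ℚᵘ./ v ℚᵘ.- + 1 ℚᵘ./ 1) ℚᵘ.* (+ n ℚᵘ./ 1)) ℚᵘ.* (+ 1 ℚᵘ./ d)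

toℚᵘ-/ : ∀ m d .{{_ : NonZero d}} → toℚᵘ (m ℚ./ d) ℚᵘ.≃ (m ℚᵘ./ d)
toℚᵘ-/ m (suc d) = ℚP.toℚᵘ-fromℚᵘ (ℚᵘ.mkℚᵘ m d)

toℚᵘ-boundℚ : ∀ v d n S .{{_ : NonZero v}} .{{_ : NonZero d}} → toℚᵘ (boundℚ v d n S) ℚᵘ.≃ boundᵘ v d n S
toℚᵘ-boundℚ v d n S =
  ℚᵘP.≃-trans (ℚP.toℚᵘ-homo-* (A ℚ.* N) D) (ℚᵘP.*-cong
    (ℚᵘP.≃-trans (ℚP.toℚᵘ-homo-* A N) (ℚᵘP.*-cong difference (toℚᵘ-/ (+ n) 1)))
    (toℚᵘ-/ (+ 1) d))
  where
  A = + v ℚ./ 1 ℚ.- + S ℚ./ v ℚ.- + 1 ℚ./ 1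
  N = + n ℚ./ 1
  D = + 1 ℚ./ d
  negated : ∀ m d .{{_ : NonZero d}} → toℚᵘ (ℚ.- (m ℚ./ d)) ℚᵘ.≃ ℚᵘ.- (m ℚᵘ./ d)
  negated m d = ℚᵘP.≃-trans (ℚP.toℚᵘ-homo‿- (m ℚ./ d)) (ℚᵘP.-‿cong (toℚᵘ-/ m d))
  difference : toℚᵘ A ℚᵘ.≃ (+ v ℚᵘ./ 1 ℚᵘ.- + S ℚᵘ./ v ℚᵘ.- + 1 ℚᵘ./ 1)
  difference = ℚᵘP.≃-trans (ℚP.toℚᵘ-homo-+ (+ v ℚ./ 1 ℚ.- + S ℚ./ v) (ℚ.- (+ 1 ℚ./ 1))) (ℚᵘP.+-cong
    (ℚᵘP.≃-trans (ℚP.toℚᵘ-homo-+ (+ v ℚ./ 1) (ℚ.- (+ S ℚ./ v))) (ℚᵘP.+-cong (toℚᵘ-/ (+ v) 1) (negated (+ S) v)))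
    (negated (+ 1) 1))

boundᵘ-≥ : ∀ v d n S (k : ℕ) .{{_ : NonZero v}} .{{_ : NonZero d}} →
           + k ℤ.* (+ v ℤ.* + d) ℤ.≤ (+ v ℤ.* + v ℤ.- + S ℤ.- + v) ℤ.* + n →
           (+ k ℚᵘ./ 1) ℚᵘ.≤ boundᵘ v d n S
boundᵘ-≥ v@(suc _) d@(suc _) n S k h = *≤* (subst₂ ℤ._≤_ (cong (+ k ℤ.*_) denominator) numerator h)
  where
  -- ↧ and ↥ of boundᵘ as the unnormalised operations compute them.
  denominator : + v ℤ.* + d ≡ + ((((1 * v) * 1) * 1) * d)
  denominator = trans (≡-sym (ℤP.pos-* v d)) (cong +_ (units v d))
    where
    units : ∀ v d → v * d ≡ (((1 * v) * 1) * 1) * d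
    units = ℕSolver.solve-∀
  numerator : (+ v ℤ.* + v ℤ.- + S ℤ.- + v) ℤ.* + n ≡
              ((((+ v ℤ.* + v ℤ.+ (- + S) ℤ.* + 1) ℤ.* + 1 ℤ.+ (- + 1) ℤ.* + (1 * v)) ℤ.* + n) ℤ.* + 1) ℤ.* + 1
  numerator = trans (cong (λ W → (+ v ℤ.* + v ℤ.- + S ℤ.- W) ℤ.* + n) (cong +_ (≡-sym (ℕP.*-identityˡ v))))
                    (normalise (+ v) (+ (1 * v)) (+ S) (+ n))
    where
    normalise : ∀ (V W S N : ℤ) → (V ℤ.* V ℤ.- S ℤ.- W) ℤ.* N ≡
                ((((V ℤ.* V ℤ.+ (- S) ℤ.* + 1) ℤ.* + 1 ℤ.+ (- + 1) ℤ.* W) ℤ.* N) ℤ.* + 1) ℤ.* + 1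
    normalise = ℤSolver.solve-∀

floor-bound : ∀ v d n S (k : ℕ) .{{_ : NonZero v}} .{{_ : NonZero d}} →
              + k ℤ.* (+ v ℤ.* + d) ℤ.≤ (+ v ℤ.* + v ℤ.- + S ℤ.- + v) ℤ.* + n →
              + k ℤ.≤ floor (boundℚ v d n S)
floor-bound v d n S k h = floor-greatest (boundℚ v d n S) (+ k)
  (ℚᵘP.≤-respʳ-≃ (ℚᵘP.≃-sym (toℚᵘ-boundℚ v d n S)) (boundᵘ-≥ v d n S k h))

theorem1p3 : ∀ {v : ℕ} (G : Graph v) (n : ℕ) (0<n : 0 < n) (n<v : n < v)
               (k : ℕ) (F : Fin k → Coloring G n) → PairwiseOrthogonal F →
               + k ≤ bound G n 0<n n<v
theorem1p3 {v} G n 0<n n<v k F orth =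
  floor-bound v (v ∸ n) n (degreeSum G) k {{ℕ.>-nonZero 0<v}} {{ℕ.>-nonZero (ℕP.m<n⇒0<n∸m n<v)}}
    (counting-inequalityℤ k v n (degreeSum G) (ℕP.<⇒≤ n<v) (counting-inequality F orth))
  where
  0<v : 0 < v
  0<v = ℕP.≤-<-trans z≤n n<v
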